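{- Let $G$ be a graph, let $b$ be a positive integer, and let $L$ and $L'$ be list assignments for $G$ such that $L'$ is formed from $L$ by a sequence of flattening moves. Then there is an injective map from the set of $b$-fold $L'$-colorings of $G$ to the set of $b$-fold $L$-colorings of $G$.
   Context: A list assignment $L$ assigns to each vertex $v$ a set $L(v)$ of colors; $\mathrm{pot}(L)=\bigcup_{v}L(v)$. A $b$-fold $L$-coloring is a function $\varphi$ with $\varphi(v)\subseteq L(v)$, $|\varphi(v)|=b$ for all $v$, and $\varphi(x)\cap\varphi(y)=\emptyset$ for every edge $xy$. For $\alpha\in\mathrm{pot}(L)$, $G_\alpha$ is the subgraph of $G$ induced by the vertices whose lists contain $\alpha$. A flattening move for $L$: choose $\alpha\in\mathrm{pot}(L)$, a connected component $C$ of $G_\alpha$, and a color $\beta\in\mathrm{pot}(L)\setminus\bigcup_{v\in V(C)}L(v)$, and replace $\alpha$ by $\beta$ in $L(v)$ for each $v\in V(C)$. -}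

module Defs where

open import Data.Nat using (ℕ)
open import Data.Bool using (Bool; true; false)
open import Data.Fin using (Fin)
open import Data.Fin.Subset using (Subset; _∈_; _∉_; _⊆_; _∪_; _∩_; _-_; ⁅_⁆; ∣_∣; ⊥)
open import Data.Product using (Σ; ∃; _×_; proj₁)
open import Relation.Nullary using (¬_)
open import Relation.Binary.PropositionalEquality using (_≡_)
open import Relation.Binary.Construct.Closure.ReflexiveTransitive using (Star)

record Graph (n : ℕ) : Set where
  field
    adj    : Fin n → Fin n → Bool
    sym    : ∀ x y → adj x y ≡ adj y x
    irrefl : ∀ x → adj x x ≡ false
open Graph public

Edge : ∀ {n} → Graph n → Fin n → Fin n → Set
Edge G x y = adj G x y ≡ true

ListAssignment : ℕ → ℕ → Set
ListAssignment n k = Fin n → Subset k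

InPot : ∀ {n k} → ListAssignment n k → Fin k → Set
InPot L α = ∃ λ w → α ∈ L w

record IsColoring {n k} (G : Graph n) (b : ℕ) (L : ListAssignment n k)
                  (φ : Fin n → Subset k) : Set where
  field
    sub      : ∀ v → φ v ⊆ L v
    size     : ∀ v → ∣ φ v ∣ ≡ b
    disjoint : ∀ x y → Edge G x y → φ x ∩ φ y ≡ ⊥

Coloring : ∀ {n k} → Graph n → ℕ → ListAssignment n k → Set
Coloring G b L = Σ _ (IsColoring G b L)

_≈ᶜ_ : ∀ {n k} {G : Graph n} {b : ℕ} {L : ListAssignment n k} →
       Coloring G b L → Coloring G b L → Set
φ ≈ᶜ ψ = ∀ v → proj₁ φ v ≡ proj₁ ψ v

record InjectiveMap {n k} (G : Graph n) (b : ℕ) (L₁ L₂ : ListAssignment n k) : Set where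
  field
    to        : Coloring G b L₁ → Coloring G b L₂
    to-cong   : ∀ φ ψ → φ ≈ᶜ ψ → to φ ≈ᶜ to ψ
    injective : ∀ φ ψ → to φ ≈ᶜ to ψ → φ ≈ᶜ ψ

-- Reach G L α u v : v lies in the connected component of G_α containing u.
data Reach {n k} (G : Graph n) (L : ListAssignment n k) (α : Fin k) (u : Fin n) :
           Fin n → Set where
  here : α ∈ L u → Reach G L α u u
  step : ∀ {v w} → Reach G L α u v → Edge G v w → α ∈ L w → Reach G L α u w

record FlatMove {n k} (G : Graph n) (L L' : ListAssignment n k) : Set where
  field
    α β      : Fin k
    u        : Fin n
    α∈Lu     : α ∈ L u
    β-pot    : InPot L β
    β-fresh  : ∀ v → Reach G L α u v → β ∉ L v
    inside   : ∀ v → Reach G L α u v → L' v ≡ (L v - α) ∪ ⁅ β ⁆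
    outside  : ∀ v → ¬ Reach G L α u v → L' v ≡ L v

Flattens : ∀ {n k} → Graph n → ListAssignment n k → ListAssignment n k → Set
Flattens G = Star (FlatMove G)

module Submission where

-- Undoing a single flattening move (α replaced by β on a component C of G_α) amounts to
-- exchanging the colours α and β at every vertex of C.  Inside C the new lists are the old
-- ones with α and β exchanged, so the exchange maps L'-colourings into L-colourings; an
-- edge leaving C cannot end up monochromatic, because α is missing from the lists of C
-- after the move and a neighbour of C carrying α in its list would lie in C itself.  The
-- exchange is invertible at every vertex, so the map is injective, and injections compose
-- along the sequence of moves.

open import Defs hiding (sym)
open import Data.Nat using (ℕ; suc; _≥_)
open import Data.Bool using (true; false)
open import Data.Empty using (⊥; ⊥-elim)
open import Data.Fin using (Fin; zero; suc; _≟_)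
open import Data.Fin.Permutation.Components using (transpose; transpose-inverse)
open import Data.Fin.Subset
  using (Subset; inside; outside; _∈_; _∉_; _⊆_; _∩_; _─_; _-_; ⁅_⁆; ∣_∣)
  renaming (⊥ to ∅)
open import Data.Fin.Subset.Properties
  using (_∈?_; ⊆-antisym; Empty-unique; ∉⊥; x∈⁅x⁆; x∈⁅y⁆⇒x≡y; x∈p∩q⁺; x∈p∩q⁻; x∈p∪q⁺; x∈p∪q⁻; p─q⊆p)
open import Data.Product using (_×_; _,_)
open import Data.Sum using (_⊎_; inj₁; inj₂; map₂)
open import Data.Vec using (_∷_; here; there; lookup; _[_]≔_)
open import Data.Vec.Properties
  using ([]=⇒lookup; lookup⇒[]=; lookup∘update; lookup∘update′; []≔-lookup; []≔-commutes)
open import Function using (_∘_; flip)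
open import Relation.Nullary using (¬_; yes; no; contradiction; _×-dec_; ¬?)
open import Relation.Nullary.Decidable using (decidable-stable)
open import Relation.Unary using (Decidable)
open import Relation.Binary.PropositionalEquality
  using (_≡_; _≢_; refl; sym; trans; cong; subst)
open import Relation.Binary.Construct.Closure.ReflexiveTransitive using (fold)

private variable
  k : ℕ

transpose-j≡i : ∀ (i j : Fin k) → transpose i j j ≡ i
transpose-j≡i i j with j ≟ i
... | yes j≡i = j≡i
... | no  _ with j ≟ j
...   | yes _   = refl
...   | no  j≢j = contradiction refl j≢j

transpose-fixes : ∀ {i j c : Fin k} → c ≢ i → c ≢ j → transpose i j c ≡ c
transpose-fixes {i = i} {j} {c} c≢i c≢j with c ≟ i
... | yes c≡i = contradiction c≡i c≢i
... | no  _ with c ≟ j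
...   | yes c≡j = contradiction c≡j c≢j
...   | no  _   = refl

swap : Fin k → Fin k → Subset k → Subset k
swap α β s = s [ α ]≔ lookup s β [ β ]≔ lookup s α

lookup-swap : ∀ α β (s : Subset k) c → lookup (swap α β s) c ≡ lookup s (transpose α β c)
lookup-swap α β s c with c ≟ α
... | yes refl with c ≟ β
...   | yes refl = lookup∘update c (s [ c ]≔ lookup s c) (lookup s c)
...   | no  c≢β  = trans (lookup∘update′ c≢β (s [ c ]≔ lookup s β) (lookup s c))
                         (lookup∘update c s (lookup s β))
lookup-swap α β s c | no c≢α with c ≟ β
...   | yes refl = lookup∘update c (s [ α ]≔ lookup s c) (lookup s α)
...   | no  c≢β  = trans (lookup∘update′ c≢β (s [ α ]≔ lookup s β) (lookup s α))
                         (lookup∘update′ c≢α s (lookup s β))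

∈-swap⁻ : ∀ {α β c} {s : Subset k} → c ∈ swap α β s → transpose α β c ∈ s
∈-swap⁻ {α = α} {β} {c} {s} c∈ =
  lookup⇒[]= _ s (trans (sym (lookup-swap α β s c)) ([]=⇒lookup c∈))

∈-swap⁺ : ∀ {α β c} {s : Subset k} → transpose α β c ∈ s → c ∈ swap α β s
∈-swap⁺ {α = α} {β} {c} {s} τc∈ =
  lookup⇒[]= c _ (trans (lookup-swap α β s c) ([]=⇒lookup τc∈))

swap-mono : ∀ {α β} {s t : Subset k} → s ⊆ t → swap α β s ⊆ swap α β t
swap-mono s⊆t = ∈-swap⁺ ∘ s⊆t ∘ ∈-swap⁻

swap-injective : ∀ α β {s t : Subset k} → swap α β s ≡ swap α β t → s ≡ t
swap-injective α β eq = ⊆-antisym (unswap eq) (unswap (sym eq))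
  where
  unswap : ∀ {s t} → swap α β s ≡ swap α β t → s ⊆ t
  unswap {s} {t} eq {c} c∈s = subst (_∈ t) (transpose-inverse α β)
    (∈-swap⁻ (subst (transpose β α c ∈_) eq
      (∈-swap⁺ (subst (_∈ s) (sym (transpose-inverse α β)) c∈s))))

lookup≡outside⇒∉ : ∀ {x} {p : Subset k} → lookup p x ≡ outside → x ∉ p
lookup≡outside⇒∉ px≡outside x∈p =
  contradiction (trans (sym px≡outside) ([]=⇒lookup x∈p)) λ ()

x∈p⇒∣p[x]≔outside∣+1≡∣p∣ : ∀ {x} {p : Subset k} → x ∈ p → suc ∣ p [ x ]≔ outside ∣ ≡ ∣ p ∣
x∈p⇒∣p[x]≔outside∣+1≡∣p∣ here = refl
x∈p⇒∣p[x]≔outside∣+1≡∣p∣ {p = inside  ∷ p} (there x∈p) = cong suc (x∈p⇒∣p[x]≔outside∣+1≡∣p∣ x∈p)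
x∈p⇒∣p[x]≔outside∣+1≡∣p∣ {p = outside ∷ p} (there x∈p) = x∈p⇒∣p[x]≔outside∣+1≡∣p∣ x∈p

x∉p⇒∣p[x]≔inside∣≡∣p∣+1 : ∀ {x} {p : Subset k} → x ∉ p → ∣ p [ x ]≔ inside ∣ ≡ suc ∣ p ∣
x∉p⇒∣p[x]≔inside∣≡∣p∣+1 {x = zero}  {outside ∷ p} x∉p = refl
x∉p⇒∣p[x]≔inside∣≡∣p∣+1 {x = zero}  {inside  ∷ p} x∉p = contradiction here x∉p
x∉p⇒∣p[x]≔inside∣≡∣p∣+1 {x = suc x} {inside  ∷ p} x∉p = cong suc (x∉p⇒∣p[x]≔inside∣≡∣p∣+1 (x∉p ∘ there))
x∉p⇒∣p[x]≔inside∣≡∣p∣+1 {x = suc x} {outside ∷ p} x∉p = x∉p⇒∣p[x]≔inside∣≡∣p∣+1 (x∉p ∘ there)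

∣p[x]≔outside[y]≔inside∣≡∣p∣ : ∀ {x y} {p : Subset k} → x ∈ p → y ∉ p →
                               ∣ p [ x ]≔ outside [ y ]≔ inside ∣ ≡ ∣ p ∣
∣p[x]≔outside[y]≔inside∣≡∣p∣ {x = x} {y} {p} x∈p y∉p =
  trans (x∉p⇒∣p[x]≔inside∣≡∣p∣+1 y∉p[x]≔outside) (x∈p⇒∣p[x]≔outside∣+1≡∣p∣ x∈p)
  where
  y≢x : y ≢ x
  y≢x refl = y∉p x∈p
  y∉p[x]≔outside : y ∉ p [ x ]≔ outside
  y∉p[x]≔outside y∈ =
    y∉p (lookup⇒[]= y p (trans (sym (lookup∘update′ y≢x p outside)) ([]=⇒lookup y∈)))

update-update-lookup : ∀ {i j x} {s : Subset k} → lookup s i ≡ x → lookup s j ≡ x →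
                       s [ i ]≔ x [ j ]≔ x ≡ s
update-update-lookup {i = i} {j} {s = s} refl sj≡si =
  trans (cong (_[ j ]≔ lookup s i) ([]≔-lookup s i))
        (trans (cong (s [ j ]≔_) (sym sj≡si)) ([]≔-lookup s j))

∣swap∣≡∣s∣ : ∀ α β (s : Subset k) → ∣ swap α β s ∣ ≡ ∣ s ∣
∣swap∣≡∣s∣ α β s with lookup s α in sα | lookup s β in sβ
... | true  | true  = cong ∣_∣ (update-update-lookup {s = s} sα sβ)
... | false | false = cong ∣_∣ (update-update-lookup {s = s} sα sβ)
... | true  | false = ∣p[x]≔outside[y]≔inside∣≡∣p∣ (lookup⇒[]= α s sα) (lookup≡outside⇒∉ sβ)
... | false | true  = trans (cong ∣_∣ ([]≔-commutes s α β α≢β))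
                            (∣p[x]≔outside[y]≔inside∣≡∣p∣ (lookup⇒[]= β s sβ) (lookup≡outside⇒∉ sα))
  where
  α≢β : α ≢ β
  α≢β refl = contradiction (trans (sym sα) sβ) λ ()

Disjoint : Subset k → Subset k → Set
Disjoint p q = ∀ {x} → x ∈ p → x ∈ q → ⊥

∩≡∅⇒disjoint : ∀ {p q : Subset k} → p ∩ q ≡ ∅ → Disjoint p q
∩≡∅⇒disjoint p∩q≡∅ x∈p x∈q = ∉⊥ (subst (_ ∈_) p∩q≡∅ (x∈p∩q⁺ (x∈p , x∈q)))

disjoint⇒∩≡∅ : ∀ {p q : Subset k} → Disjoint p q → p ∩ q ≡ ∅
disjoint⇒∩≡∅ {p = p} {q} p#q = Empty-unique λ (x , x∈p∩q) →
  let (x∈p , x∈q) = x∈p∩q⁻ p q x∈p∩q in p#q x∈p x∈q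

x∈p─q⇒x∉q : ∀ {x} {p q : Subset k} → x ∈ p ─ q → x ∉ q
x∈p─q⇒x∉q {p = inside  ∷ p} {outside ∷ q} (there x∈p─q) (there x∈q) = x∈p─q⇒x∉q x∈p─q x∈q
x∈p─q⇒x∉q {p = outside ∷ p} {outside ∷ q} (there x∈p─q) (there x∈q) = x∈p─q⇒x∉q x∈p─q x∈q
x∈p─q⇒x∉q {p = _       ∷ p} {inside  ∷ q} (there x∈p─q) (there x∈q) = x∈p─q⇒x∉q x∈p─q x∈q

InjectiveMap-refl : ∀ {n k} {G : Graph n} {b} {L : ListAssignment n k} → InjectiveMap G b L L
InjectiveMap-refl = record { to = λ φ → φ ; to-cong = λ _ _ φ≈ψ → φ≈ψ ; injective = λ _ _ φ≈ψ → φ≈ψ }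

InjectiveMap-trans : ∀ {n k} {G : Graph n} {b} {L₁ L₂ L₃ : ListAssignment n k} →
                     InjectiveMap G b L₁ L₂ → InjectiveMap G b L₂ L₃ → InjectiveMap G b L₁ L₃
InjectiveMap-trans f g = record
  { to        = G.to ∘ F.to
  ; to-cong   = λ φ ψ φ≈ψ → G.to-cong _ _ (F.to-cong φ ψ φ≈ψ)
  ; injective = λ φ ψ eq → F.injective φ ψ (G.injective _ _ eq)
  }
  where
  module F = InjectiveMap f
  module G = InjectiveMap g

record ColourExchange {n k} (G : Graph n) (L' L : ListAssignment n k) : Set₁ where
  field
    Region      : Fin n → Set
    region?     : Decidable Region
    α β         : Fin k
    swap-⊆      : ∀ {v} → Region v → swap α β (L' v) ⊆ L v
    outside-⊆   : ∀ {v} → ¬ Region v → L' v ⊆ L v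
    α∉-inside   : ∀ {v} → Region v → α ∉ L' v
    α∉-boundary : ∀ {x y} → Region x → ¬ Region y → Edge G x y → α ∉ L' y

module Exchange {n k} {G : Graph n} {L' L : ListAssignment n k} (E : ColourExchange G L' L) where
  open ColourExchange E

  recolour : Fin n → Subset k → Subset k
  recolour v with region? v
  ... | yes _ = swap α β
  ... | no  _ = λ s → s

  recolour-injective : ∀ v {s t} → recolour v s ≡ recolour v t → s ≡ t
  recolour-injective v with region? v
  ... | yes _ = swap-injective α β
  ... | no  _ = λ eq → eq

  ∣recolour∣≡∣s∣ : ∀ v s → ∣ recolour v s ∣ ≡ ∣ s ∣
  ∣recolour∣≡∣s∣ v s with region? v
  ... | yes _ = ∣swap∣≡∣s∣ α β s
  ... | no  _ = refl

  recolour-⊆ : ∀ v {s} → s ⊆ L' v → recolour v s ⊆ L v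
  recolour-⊆ v s⊆L'v with region? v
  ... | yes inR = swap-⊆ inR ∘ swap-mono s⊆L'v
  ... | no  ∉R  = outside-⊆ ∉R ∘ s⊆L'v

  swap-disjoint-boundary : ∀ {x y s t} → Region x → ¬ Region y → Edge G x y →
                           s ⊆ L' x → t ⊆ L' y → Disjoint s t → Disjoint (swap α β s) t
  swap-disjoint-boundary {s = s} inx ∉y xy s⊆ t⊆ s#t {c} c∈swap c∈t with c ≟ α
  ... | yes refl = α∉-boundary inx ∉y xy (t⊆ c∈t)
  ... | no c≢α with c ≟ β
  ...   | yes refl = α∉-inside inx (s⊆ (subst (_∈ s) (transpose-j≡i α c) (∈-swap⁻ c∈swap)))
  ...   | no  c≢β  = s#t (subst (_∈ s) (transpose-fixes c≢α c≢β) (∈-swap⁻ c∈swap)) c∈t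

  recolour-disjoint : ∀ {x y s t} → Edge G x y → s ⊆ L' x → t ⊆ L' y → Disjoint s t →
                      Disjoint (recolour x s) (recolour y t)
  recolour-disjoint {x} {y} xy s⊆ t⊆ s#t with region? x | region? y
  ... | yes _   | yes _   = λ c∈s c∈t → s#t (∈-swap⁻ c∈s) (∈-swap⁻ c∈t)
  ... | yes inx | no  ∉y  = swap-disjoint-boundary inx ∉y xy s⊆ t⊆ s#t
  ... | no  ∉x  | yes iny = λ c∈s c∈t →
    swap-disjoint-boundary iny ∉x (trans (Graph.sym G y x) xy) t⊆ s⊆ (flip s#t) c∈t c∈s
  ... | no  _   | no  _   = s#t

  recolouring : ∀ {b} → Coloring G b L' → Coloring G b L
  recolouring (φ , φ-colouring) = (λ v → recolour v (φ v)) , record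
    { sub      = λ v → recolour-⊆ v (sub v)
    ; size     = λ v → trans (∣recolour∣≡∣s∣ v (φ v)) (size v)
    ; disjoint = λ x y xy → disjoint⇒∩≡∅
        (recolour-disjoint xy (sub x) (sub y) (∩≡∅⇒disjoint (disjoint x y xy)))
    }
    where open IsColoring φ-colouring

  injection : ∀ b → InjectiveMap G b L' L
  injection b = record
    { to        = recolouring
    ; to-cong   = λ φ ψ φ≈ψ v → cong (recolour v) (φ≈ψ v)
    ; injective = λ φ ψ eq v → recolour-injective v (eq v)
    }

module FlatteningMove {n k} {G : Graph n} {L L' : ListAssignment n k} (M : FlatMove G L L') where
  open FlatMove M renaming (inside to L'-inside; outside to L'-outside)

  Component : Fin n → Set
  Component = Reach G L α u

  α≢β : α ≢ β
  α≢β refl = β-fresh u (here α∈Lu) α∈Lu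

  component⇒α∈L : ∀ {v} → Component v → α ∈ L v
  component⇒α∈L (here α∈Lu)     = α∈Lu
  component⇒α∈L (step _ _ α∈Lw) = α∈Lw

  component-∈L' : ∀ {v c} → Component v → c ∈ L' v → c ∈ L v - α ⊎ c ≡ β
  component-∈L' {v} {c} r c∈L'v =
    map₂ (x∈⁅y⁆⇒x≡y β) (x∈p∪q⁻ (L v - α) ⁅ β ⁆ (subst (c ∈_) (L'-inside v r) c∈L'v))

  component⇒α∉L' : ∀ {v} → Component v → α ∉ L' v
  component⇒α∉L' r α∈L'v with component-∈L' r α∈L'v
  ... | inj₁ α∈Lv-α = x∈p─q⇒x∉q α∈Lv-α (x∈⁅x⁆ α)
  ... | inj₂ α≡β    = α≢β α≡β

  component⇒swap-⊆ : ∀ {v} → Component v → swap α β (L' v) ⊆ L v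
  component⇒swap-⊆ {v} r {c} c∈swap with c ≟ α
  ... | yes refl = component⇒α∈L r
  ... | no c≢α with c ≟ β
  ...   | yes refl =
    ⊥-elim (component⇒α∉L' r (subst (_∈ L' v) (transpose-j≡i α c) (∈-swap⁻ c∈swap)))
  ...   | no  c≢β with component-∈L' r (subst (_∈ L' v) (transpose-fixes c≢α c≢β) (∈-swap⁻ c∈swap))
  ...     | inj₁ c∈Lv-α = p─q⊆p (L v) ⁅ α ⁆ c∈Lv-α
  ...     | inj₂ c≡β    = contradiction c≡β c≢β

  -- Membership in the component is not decidable, but this decidable predicate agrees with
  -- it up to double negation, which suffices since every goal below is decidable or ⊥.
  Region : Fin n → Set
  Region v = β ∈ L' v × β ∉ L v

  component⇒region : ∀ {v} → Component v → Region v
  component⇒region {v} r =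
    subst (β ∈_) (sym (L'-inside v r)) (x∈p∪q⁺ (inj₂ (x∈⁅x⁆ β))) , β-fresh v r

  ¬region⇒L'≡L : ∀ {v} → ¬ Region v → L' v ≡ L v
  ¬region⇒L'≡L {v} ∉R = L'-outside v (∉R ∘ component⇒region)

  region⇒¬¬component : ∀ {v} → Region v → ¬ ¬ Component v
  region⇒¬¬component {v} (β∈L'v , β∉Lv) ∉C = β∉Lv (subst (β ∈_) (L'-outside v ∉C) β∈L'v)

  exchange : ColourExchange G L' L
  exchange = record
    { Region      = Region
    ; region?     = λ v → (β ∈? L' v) ×-dec ¬? (β ∈? L v)
    ; α           = α
    ; β           = β
    ; swap-⊆      = λ {v} inR {c} c∈swap → decidable-stable (c ∈? L v) λ c∉Lv →
                      region⇒¬¬component inR (λ r → c∉Lv (component⇒swap-⊆ r c∈swap))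
    ; outside-⊆   = λ ∉R → subst (_ ∈_) (¬region⇒L'≡L ∉R)
    ; α∉-inside   = λ inR α∈L'v → region⇒¬¬component inR (λ r → component⇒α∉L' r α∈L'v)
    ; α∉-boundary = λ inx ∉y xy α∈L'y → region⇒¬¬component inx λ rx →
                      ∉y (component⇒region (step rx xy (subst (α ∈_) (¬region⇒L'≡L ∉y) α∈L'y)))
    }

lemma23 : ∀ {n k} (G : Graph n) (b : ℕ) → b ≥ 1 →
          (L L' : ListAssignment n k) → Flattens G L L' →
          InjectiveMap G b L' L
lemma23 G b _ L L' = fold (flip (InjectiveMap G b))
  (λ move rest → InjectiveMap-trans rest (Exchange.injection (FlatteningMove.exchange move) b))
  InjectiveMap-refl
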